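{- Let $\ell\ge2$, $k\ge1$, and let $\lambda$ be an $\ell$-core with $len(\lambda)=k$. Then: (1) in each row of $\lambda$, exactly one of the boxes deleted in forming $\widetilde{\Phi_\ell^k}(\lambda)$ has hook length (in $\lambda$) less than $\ell$; (2) if $\mathsf{B}$ is a box of $\lambda$ not deleted in forming $\widetilde{\Phi_\ell^k}(\lambda)$ and $\widetilde{\mathsf{B}}$ is the corresponding box of $\widetilde{\Phi_\ell^k}(\lambda)$, then $h^\lambda_{\mathsf{B}}<\ell$ if and only if $h^{\widetilde{\Phi_\ell^k}(\lambda)}_{\widetilde{\mathsf{B}}}<\ell-1$.
   Context: Partitions are in English notation; $len(\lambda)$ is the number of nonzero parts; $h^\lambda_{(x,y)}$ is the hook length of box $(x,y)$ of $\lambda$ (boxes weakly right in its row or weakly below in its column). An $m$-core is a partition none of whose hook lengths is divisible by $m$. For an $\ell$-core $\lambda$ with $len(\lambda)=k$, $\widetilde{\Phi_\ell^k}(\lambda)$ is obtained from the diagram of $\lambda$ by deleting every column $j$ with $h^\lambda_{(1,j)}\equiv h^\lambda_{(1,1)}\pmod\ell$ and closing up the gaps; it is an $(\ell-1)$-core. A box $(x,y)$ of $\lambda$ in a non-deleted column corresponds to the box $(x,y-d)$ of $\widetilde{\Phi_\ell^k}(\lambda)$, where $d$ is the number of deleted columns $j<y$. (Boxes of hook length $<\ell$ in an $\ell$-core are the "skew boxes" of the Lapointe–Morse correspondence.) -}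

module Defs where

open import Data.Nat using (ℕ; zero; suc; _+_; _∸_; _≤_; _<_; _≥_; _≤?_; ∣_-_∣)
open import Data.Nat.Divisibility using (_∣_; _∣?_)
open import Data.List using (List; []; _∷_; length; filter; map; upTo)
open import Data.List.Relation.Unary.Linked using (Linked)
open import Data.List.Relation.Unary.All using (All)
open import Data.Product using (_×_)
open import Relation.Nullary using (¬_; Dec)

IsPartition : List ℕ → Set
IsPartition μ = Linked _≥_ μ × All (λ p → 1 ≤ p) μ

-- μ_x, 1-indexed (0 when x = 0 or x > length).
part : List ℕ → ℕ → ℕ
part []       _             = 0
part (p ∷ μ)  zero          = 0
part (p ∷ μ)  (suc zero)    = p
part (p ∷ μ)  (suc (suc x)) = part μ (suc x)

conj : List ℕ → ℕ → ℕ
conj μ y = length (filter (y ≤?_) μ)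

-- box (x,y) (row x, column y, both 1-indexed) lies in the diagram of μ
InDiagram : List ℕ → ℕ → ℕ → Set
InDiagram μ x y = 1 ≤ x × 1 ≤ y × y ≤ part μ x

hook : List ℕ → ℕ → ℕ → ℕ
hook μ x y = (part μ x ∸ y) + (conj μ y ∸ x) + 1

IsCore : ℕ → List ℕ → Set
IsCore m μ = ∀ x y → InDiagram μ x y → ¬ (m ∣ hook μ x y)

_≡_[mod_] : ℕ → ℕ → ℕ → Set
a ≡ b [mod m ] = m ∣ ∣ a - b ∣

Deleted : ℕ → List ℕ → ℕ → Set
Deleted ℓ μ j = hook μ 1 j ≡ hook μ 1 1 [mod ℓ ]

deleted? : ∀ ℓ μ j → Dec (Deleted ℓ μ j)
deleted? ℓ μ j = ℓ ∣? ∣ hook μ 1 j - hook μ 1 1 ∣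

nDeletedUpTo : ℕ → List ℕ → ℕ → ℕ
nDeletedUpTo ℓ μ n = length (filter (λ i → deleted? ℓ μ (suc i)) (upTo n))

shift : ℕ → List ℕ → ℕ → ℕ
shift ℓ μ y = nDeletedUpTo ℓ μ (y ∸ 1)

-- Φ̃ : delete the deleted columns and close up; row x keeps μ_x − #{deleted j ≤ μ_x}
-- boxes; rows that become empty are dropped (they are at the bottom).
Phi : ℕ → List ℕ → List ℕ
Phi ℓ μ = filter (1 ≤?_) (map (λ p → p ∸ nDeletedUpTo ℓ μ p) μ)

module Submission where

-- With k = len λ, let β x = λ_x + (k − x) be the hook length of (x,1) and γ y = (y − 1) + (k − λ′_y),
-- so that h(x,y) = β x − γ y; the values γ y (y ≤ λ_1) and β x (x ≤ k) interleave and exhaust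
-- [0, β 1]. Column y is deleted iff ℓ ∣ γ y. Since λ is an ℓ-core no β x is a multiple of ℓ, so
-- every multiple of ℓ below β x equals some γ y with y ≤ λ_x; in row x the deleted box with hook < ℓ
-- is the one with γ y = ℓ ⌊β x / ℓ⌋, and it is unique. For a kept box (x,y), let e be the number
-- of deleted columns in (y, λ_x]: then γ y and β x lie strictly inside ℓ-blocks e apart, the hook
-- drops by exactly e, and h < ℓ ⇔ h − e < ℓ − 1 because e = 0 makes both small, e = 1 shifts both
-- thresholds by one, and e ≥ 2 makes both large.

open import Defs
open import Data.Nat
open import Data.Nat.Properties
open import Data.Nat.Divisibility using (_∣_; divides; n∣m*n)
open import Data.Nat.Tactic.RingSolver using (solve-∀)
open import Data.List using (List; []; _∷_; length; filter; map; upTo; _++_)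
open import Data.List.Properties
  using (length-filter; filter-accept; filter-reject; filter-all; filter-++; length-++; upTo-∷ʳ)
open import Data.List.Relation.Unary.All as All using (All; []; _∷_)
open import Data.List.Relation.Unary.Linked as Linked using (Linked)
open import Data.List.Relation.Unary.Linked.Properties using (Linked⇒All; map⁺)
open import Data.Product using (∃-syntax; _×_; _,_; proj₁; proj₂)
open import Data.Sum using (inj₁; inj₂)
open import Relation.Binary.Definitions using (tri<; tri≈; tri>)
open import Function.Base using (_∘_; flip)
open import Function.Bundles using (_⇔_; mk⇔; Equivalence)
open import Relation.Nullary using (¬_; yes; no; contradiction)
open import Relation.Unary using (Decidable)
open import Relation.Binary.PropositionalEquality

tail-≤-head : ∀ {p μ} → Linked _≥_ (p ∷ μ) → All (_≤ p) μ
tail-≤-head μ↘ = All.tail (Linked⇒All (flip ≤-trans) ≤-refl μ↘)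

part-≤ : ∀ {p μ} → All (_≤ p) μ → ∀ x → part μ x ≤ p
part-≤ []               x             = z≤n
part-≤ (q≤p ∷ _)        zero          = z≤n
part-≤ (q≤p ∷ _)        (suc zero)    = q≤p
part-≤ (_   ∷ μ≤p)      (suc (suc x)) = part-≤ μ≤p (suc x)

part-≤-part₁ : ∀ {μ} → Linked _≥_ μ → ∀ x → part μ x ≤ part μ 1
part-≤-part₁ {[]}    _  x             = z≤n
part-≤-part₁ {p ∷ μ} _  zero          = z≤n
part-≤-part₁ {p ∷ μ} _  (suc zero)    = ≤-refl
part-≤-part₁ {p ∷ μ} μ↘ (suc (suc x)) = part-≤ (tail-≤-head μ↘) (suc x)

conj-≡0 : ∀ {p μ y} → All (_≤ p) μ → p < y → conj μ y ≡ 0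
conj-≡0 []                     _   = refl
conj-≡0 {p} {q ∷ μ} {y} (q≤p ∷ μ≤p) p<y
  rewrite filter-reject (y ≤?_) {q} {μ} (λ y≤q → <⇒≱ p<y (≤-trans y≤q q≤p)) = conj-≡0 μ≤p p<y

conj-≤-length : ∀ μ y → conj μ y ≤ length μ
conj-≤-length μ y = length-filter (y ≤?_) μ

conj-antitone : ∀ μ {y y′} → y ≤ y′ → conj μ y′ ≤ conj μ y
conj-antitone []      y≤y′ = z≤n
conj-antitone (p ∷ μ) {y} {y′} y≤y′ with y′ ≤? p | y ≤? p
... | yes y′≤p | _       rewrite filter-accept (y′ ≤?_) {p} {μ} y′≤p
                               | filter-accept (y ≤?_) {p} {μ} (≤-trans y≤y′ y′≤p) =
  s≤s (conj-antitone μ y≤y′)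
... | no y′≰p  | yes y≤p rewrite filter-reject (y′ ≤?_) {p} {μ} y′≰p
                               | filter-accept (y ≤?_) {p} {μ} y≤p = m≤n⇒m≤1+n (conj-antitone μ y≤y′)
... | no y′≰p  | no y≰p  rewrite filter-reject (y′ ≤?_) {p} {μ} y′≰p
                               | filter-reject (y ≤?_) {p} {μ} y≰p = conj-antitone μ y≤y′

≤conj⇒≤part : ∀ {μ} → Linked _≥_ μ → ∀ x y → suc x ≤ conj μ y → y ≤ part μ (suc x)
≤conj⇒≤part {[]}    _  x y ()
≤conj⇒≤part {p ∷ μ} μ↘ x y x<conj with y ≤? p
... | no y≰p rewrite filter-reject (y ≤?_) {p} {μ} y≰p
                   | conj-≡0 {p} {μ} {y} (tail-≤-head μ↘) (≰⇒> y≰p) with () ← x<conj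
≤conj⇒≤part {p ∷ μ} μ↘ zero    y x<conj | yes y≤p = y≤p
≤conj⇒≤part {p ∷ μ} μ↘ (suc x) y x<conj | yes y≤p rewrite filter-accept (y ≤?_) {p} {μ} y≤p =
  ≤conj⇒≤part (Linked.tail μ↘) x y (s≤s⁻¹ x<conj)

≤part⇒≤conj : ∀ {μ} → Linked _≥_ μ → ∀ x y → 1 ≤ y → y ≤ part μ (suc x) →
              suc x ≤ conj μ y
≤part⇒≤conj {[]}    _  x (suc y) _ ()
≤part⇒≤conj {p ∷ μ} _  zero    y _ y≤p rewrite filter-accept (y ≤?_) {p} {μ} y≤p = s≤s z≤n
≤part⇒≤conj {p ∷ μ} μ↘ (suc x) y 1≤y y≤part
  rewrite filter-accept (y ≤?_) {p} {μ} (≤-trans y≤part (part-≤ (tail-≤-head μ↘) (suc x))) =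
  s≤s (≤part⇒≤conj (Linked.tail μ↘) x y 1≤y y≤part)

0<hook : ∀ μ x y → 0 < hook μ x y
0<hook μ x y = m≤n+m 1 (part μ x ∸ y + (conj μ y ∸ x))

part-map : ∀ (f : ℕ → ℕ) → f 0 ≡ 0 → ∀ μ x → part (map f μ) x ≡ f (part μ x)
part-map f f0≡0 []      x             = sym f0≡0
part-map f f0≡0 (p ∷ μ) zero          = sym f0≡0
part-map f f0≡0 (p ∷ μ) (suc zero)    = refl
part-map f f0≡0 (p ∷ μ) (suc (suc x)) = part-map f f0≡0 μ (suc x)

conj-map : ∀ (f : ℕ → ℕ) {y y′} → (∀ p → y′ ≤ f p ⇔ y ≤ p) →
           ∀ μ → conj (map f μ) y′ ≡ conj μ y
conj-map f         f-reflects []      = refl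
conj-map f {y} {y′} f-reflects (p ∷ μ) with y ≤? p
... | yes y≤p rewrite filter-accept (y ≤?_) {p} {μ} y≤p
                    | filter-accept (y′ ≤?_) {f p} {map f μ} (Equivalence.from (f-reflects p) y≤p) =
  cong suc (conj-map f f-reflects μ)
... | no y≰p  rewrite filter-reject (y ≤?_) {p} {μ} y≰p
                    | filter-reject (y′ ≤?_) {f p} {map f μ} (y≰p ∘ Equivalence.to (f-reflects p)) =
  conj-map f f-reflects μ

dropZeros : List ℕ → List ℕ
dropZeros = filter (1 ≤?_)

dropZeros-≤0 : ∀ {ν} → All (_≤ 0) ν → dropZeros ν ≡ []
dropZeros-≤0 []                = refl
dropZeros-≤0 {_ ∷ ν} (z≤n ∷ ν≤0) rewrite filter-reject (1 ≤?_) {0} {ν} (λ ()) = dropZeros-≤0 ν≤0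

part-dropZeros : ∀ {ν} → Linked _≥_ ν → ∀ x → part (dropZeros ν) x ≡ part ν x
part-dropZeros {[]}        _  x = refl
part-dropZeros {zero ∷ ν}  ν↘ x rewrite filter-reject (1 ≤?_) {zero} {ν} (λ ())
                                      | dropZeros-≤0 (tail-≤-head ν↘) =
  sym (n≤0⇒n≡0 (part-≤ (z≤n ∷ tail-≤-head ν↘) x))
part-dropZeros {suc p ∷ ν} ν↘ x rewrite filter-accept (1 ≤?_) {suc p} {ν} (s≤s z≤n) with x
... | zero          = refl
... | suc zero      = refl
... | suc (suc x′)  = part-dropZeros (Linked.tail ν↘) (suc x′)

conj-dropZeros : ∀ ν y → 1 ≤ y → conj (dropZeros ν) y ≡ conj ν y
conj-dropZeros []          y _ = refl
conj-dropZeros (zero ∷ ν)  y 1≤y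
  rewrite filter-reject (1 ≤?_) {zero} {ν} (λ ())
        | filter-reject (y ≤?_) {zero} {ν} (<⇒≱ 1≤y) = conj-dropZeros ν y 1≤y
conj-dropZeros (suc p ∷ ν) y 1≤y rewrite filter-accept (1 ≤?_) {suc p} {ν} (s≤s z≤n) with y ≤? suc p
... | yes y≤p rewrite filter-accept (y ≤?_) {suc p} {dropZeros ν} y≤p
                    | filter-accept (y ≤?_) {suc p} {ν} y≤p = cong suc (conj-dropZeros ν y 1≤y)
... | no y≰p  rewrite filter-reject (y ≤?_) {suc p} {dropZeros ν} y≰p
                    | filter-reject (y ≤?_) {suc p} {ν} y≰p = conj-dropZeros ν y 1≤y

difference-window : ∀ {ℓ B e g a h} → B * ℓ < g → g < suc B * ℓ →
                    (B + e) * ℓ < a → a < suc (B + e) * ℓ → h + g ≡ a →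
                    2 + h ≤ suc e * ℓ × 2 + e * ℓ ≤ h + ℓ
difference-window {ℓ} {B} {e} {g} {a} {h} Bℓ<g g<B′ℓ Beℓ<a a<Be′ℓ refl = upper , lower
  where
  open ≤-Reasoning
  upper : 2 + h ≤ suc e * ℓ
  upper = +-cancelʳ-≤ (B * ℓ) (2 + h) (suc e * ℓ) (begin
    2 + h + B * ℓ         ≡⟨ cong suc (+-suc h (B * ℓ)) ⟨
    suc (h + suc (B * ℓ)) ≤⟨ s≤s (+-monoʳ-≤ h Bℓ<g) ⟩
    suc (h + g)           ≤⟨ a<Be′ℓ ⟩
    suc (B + e) * ℓ       ≡⟨ shuffle B e ℓ ⟩
    suc e * ℓ + B * ℓ     ∎)
    where
    shuffle : ∀ B e ℓ → suc (B + e) * ℓ ≡ suc e * ℓ + B * ℓ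
    shuffle = solve-∀
  lower : 2 + e * ℓ ≤ h + ℓ
  lower = +-cancelʳ-≤ (B * ℓ) (2 + e * ℓ) (h + ℓ) (begin
    2 + e * ℓ + B * ℓ     ≡⟨ shuffle B e ℓ ⟩
    suc (suc ((B + e) * ℓ)) ≤⟨ s≤s Beℓ<a ⟩
    suc (h + g)           ≡⟨ +-suc h g ⟨
    h + suc g             ≤⟨ +-monoʳ-≤ h g<B′ℓ ⟩
    h + suc B * ℓ         ≡⟨ +-assoc h ℓ (B * ℓ) ⟨
    h + ℓ + B * ℓ         ∎)
    where
    shuffle : ∀ B e ℓ → 2 + e * ℓ + B * ℓ ≡ suc (suc ((B + e) * ℓ))
    shuffle = solve-∀

window-drop-<-iff : ∀ {ℓ e h h′} → 2 ≤ ℓ → 2 + h ≤ suc e * ℓ → 2 + e * ℓ ≤ h + ℓ →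
                    h′ + e ≡ h → h < ℓ ⇔ h′ < ℓ ∸ 1
window-drop-<-iff {ℓ@(suc (suc L))} {zero} {h} {h′} (s≤s (s≤s z≤n)) upper _ h′+0≡h =
  mk⇔ (λ _ → h′<ℓ∸1) (λ _ → h<ℓ)
  where
  h+2≤ℓ : suc (suc h) ≤ ℓ
  h+2≤ℓ = subst (suc (suc h) ≤_) (+-identityʳ ℓ) upper
  h<ℓ : h < ℓ
  h<ℓ = ≤-trans (n≤1+n (suc h)) h+2≤ℓ
  h′<ℓ∸1 : h′ < ℓ ∸ 1
  h′<ℓ∸1 = subst (_< ℓ ∸ 1) (trans (sym h′+0≡h) (+-identityʳ h′)) (s≤s⁻¹ h+2≤ℓ)
window-drop-<-iff {suc (suc L)} {suc zero} {_} {h′} (s≤s (s≤s z≤n)) _ _ refl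
  rewrite +-comm h′ 1 = mk⇔ s≤s⁻¹ s≤s
window-drop-<-iff {ℓ@(suc (suc L))} {suc (suc e)} {_} {h′} (s≤s (s≤s z≤n)) _ lower refl =
  mk⇔ (λ h<ℓ → contradiction (≤-trans ℓ≤h′ (m≤m+n h′ (2 + e))) (<⇒≱ h<ℓ))
      (λ h′<ℓ∸1 → contradiction ℓ≤h′ (<⇒≱ (≤-trans h′<ℓ∸1 (n≤1+n (suc L)))))
  where
  ℓ≤h′ : ℓ ≤ h′
  ℓ≤h′ = +-cancelʳ-≤ (e + 2 + ℓ) ℓ h′ (begin
    ℓ + (e + 2 + ℓ)           ≡⟨ shuffleˡ ℓ e ⟩
    2 + (ℓ + e) + ℓ           ≤⟨ +-monoˡ-≤ ℓ (s≤s (s≤s (+-monoʳ-≤ ℓ (m≤m*n e ℓ)))) ⟩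
    2 + (ℓ + e * ℓ) + ℓ       ≡⟨ shuffleʳ ℓ e ⟩
    2 + suc (suc e) * ℓ       ≤⟨ lower ⟩
    h′ + suc (suc e) + ℓ      ≡⟨ shuffle h′ e ℓ ⟩
    h′ + (e + 2 + ℓ)          ∎)
    where
    open ≤-Reasoning
    shuffleˡ : ∀ ℓ e → ℓ + (e + 2 + ℓ) ≡ 2 + (ℓ + e) + ℓ
    shuffleˡ = solve-∀
    shuffleʳ : ∀ ℓ e → 2 + (ℓ + e * ℓ) + ℓ ≡ 2 + (2 + e) * ℓ
    shuffleʳ = solve-∀
    shuffle : ∀ h e ℓ → h + (2 + e) + ℓ ≡ h + (e + 2 + ℓ)
    shuffle = solve-∀

quotient-unique : ∀ {ℓ q t a} → q * ℓ ≤ a → a < suc q * ℓ → t * ℓ ≤ a → a < suc t * ℓ →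
                  q ≡ t
quotient-unique {ℓ} {q} {t} qℓ≤a a<q′ℓ tℓ≤a a<t′ℓ =
  ≤-antisym (s≤s⁻¹ (*-cancelʳ-< ℓ q (suc t) (≤-<-trans qℓ≤a a<t′ℓ)))
            (s≤s⁻¹ (*-cancelʳ-< ℓ t (suc q) (≤-<-trans tℓ≤a a<q′ℓ)))

next-multiple : ∀ {ℓ a b} q → q * ℓ ≤ a → a < b → b ≤ suc q * ℓ → ℓ ∣ b → b ≡ suc q * ℓ
next-multiple {ℓ} q qℓ≤a a<b b≤q′ℓ (divides t refl) =
  ≤-antisym b≤q′ℓ (*-monoˡ-≤ ℓ (*-cancelʳ-< ℓ q t (≤-<-trans qℓ≤a a<b)))

below-next-multiple : ∀ {ℓ b} q → b ≤ suc q * ℓ → ¬ ℓ ∣ b → b < suc q * ℓ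
below-next-multiple q b≤q′ℓ ℓ∤b = ≤∧≢⇒< b≤q′ℓ (ℓ∤b ∘ divides (suc q))

∸-between : ∀ {j c₀ c₁ k n} → c₀ ≤ k → j + (k ∸ c₀) < n → n < suc j + (k ∸ c₁) →
            ∃[ i ] (c₁ < i × i ≤ c₀ × suc j + (k ∸ i) ≡ n)
∸-between {j} {c₀} {c₁} {k} {n} c₀≤k lower upper
  with m≤n⇒∃[o]m+o≡n (≤-trans (m≤m+n (suc j) (k ∸ c₀)) lower)
... | d , refl = k ∸ d , c₁<k∸d , k∸d≤c₀ , cong (suc j +_) (m∸[m∸n]≡n d≤k)
  where
  d<k∸c₁ : d < k ∸ c₁
  d<k∸c₁ = +-cancelˡ-< (suc j) d (k ∸ c₁) upper
  d≤k : d ≤ k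
  d≤k = ≤-trans (<⇒≤ d<k∸c₁) (m∸n≤m k c₁)
  k∸c₀≤d : k ∸ c₀ ≤ d
  k∸c₀≤d = +-cancelˡ-≤ j (k ∸ c₀) d (s≤s⁻¹ lower)
  k∸d≤c₀ : k ∸ d ≤ c₀
  k∸d≤c₀ = ≤-trans (∸-monoʳ-≤ k k∸c₀≤d) (≤-reflexive (m∸[m∸n]≡n c₀≤k))
  c₁<k∸d : c₁ < k ∸ d
  c₁<k∸d = subst (_< k ∸ d) (m∸[m∸n]≡n c₁≤k) (∸-monoʳ-< d<k∸c₁ (m∸n≤m k c₁))
    where
    c₁≤k : c₁ ≤ k
    c₁≤k = <⇒≤ (m∸n≢0⇒n<m (λ k∸c₁≡0 → n≮0 (subst (d <_) k∸c₁≡0 d<k∸c₁)))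

module ClosingUp {p} {P : ℕ → Set p} (P? : Decidable P) where

  count : ℕ → ℕ
  count n = length (filter (P? ∘ suc) (upTo n))

  -- the index of column n once the columns i ≤ n with P i have been deleted and the gaps closed up
  close : ℕ → ℕ
  close n = n ∸ count n

  count-suc : ∀ n → count (suc n) ≡ count n + length (filter (P? ∘ suc) (n ∷ []))
  count-suc n = begin
    length (filter P′ (upTo (suc n)))                  ≡⟨ cong (length ∘ filter P′) (upTo-∷ʳ n) ⟨
    length (filter P′ (upTo n ++ n ∷ []))              ≡⟨ cong length (filter-++ P′ (upTo n) (n ∷ [])) ⟩
    length (filter P′ (upTo n) ++ filter P′ (n ∷ []))  ≡⟨ length-++ (filter P′ (upTo n)) ⟩
    count n + length (filter P′ (n ∷ []))              ∎
    where
    open ≡-Reasoning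
    P′ : Decidable (P ∘ suc)
    P′ = P? ∘ suc

  count-suc-accept : ∀ n → P (suc n) → count (suc n) ≡ suc (count n)
  count-suc-accept n Pn+1 rewrite count-suc n | filter-accept (P? ∘ suc) {n} {[]} Pn+1 = +-comm (count n) 1

  count-suc-reject : ∀ n → ¬ P (suc n) → count (suc n) ≡ count n
  count-suc-reject n ¬Pn+1 rewrite count-suc n | filter-reject (P? ∘ suc) {n} {[]} ¬Pn+1 =
    +-identityʳ (count n)

  count-≤ : ∀ n → count n ≤ n
  count-≤ zero    = z≤n
  count-≤ (suc n) with P? (suc n)
  ... | yes Pn+1 rewrite count-suc-accept n Pn+1 = s≤s (count-≤ n)
  ... | no ¬Pn+1 rewrite count-suc-reject n ¬Pn+1 = m≤n⇒m≤1+n (count-≤ n)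

  count-+ : ∀ m t → ∃[ e ] (count (m + t) ≡ count m + e × e ≤ t)
  count-+ m zero    = 0 , trans (cong count (+-identityʳ m)) (sym (+-identityʳ (count m))) , z≤n
  count-+ m (suc t) with count-+ m t
  ... | e , eq , e≤t rewrite +-suc m t with P? (suc (m + t))
  ...   | yes P′ = suc e , trans (count-suc-accept _ P′) (trans (cong suc eq) (sym (+-suc (count m) e))) ,
                   s≤s e≤t
  ...   | no ¬P′ = e , trans (count-suc-reject _ ¬P′) eq , m≤n⇒m≤1+n e≤t

  close-+ : ∀ {m t e} → count (m + t) ≡ count m + e → e ≤ t → close (m + t) ≡ close m + (t ∸ e)
  close-+ {m} {t} {e} eq e≤t = begin
    m + t ∸ count (m + t)         ≡⟨ cong (m + t ∸_) eq ⟩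
    m + t ∸ (count m + e)         ≡⟨ ∸-+-assoc (m + t) (count m) e ⟨
    m + t ∸ count m ∸ e           ≡⟨ cong (_∸ e) (+-∸-comm t (count-≤ m)) ⟩
    (m ∸ count m) + t ∸ e         ≡⟨ +-∸-assoc (m ∸ count m) e≤t ⟩
    (m ∸ count m) + (t ∸ e)       ∎
    where open ≡-Reasoning

  close-monotone : ∀ {m n} → m ≤ n → close m ≤ close n
  close-monotone {m} m≤n with m≤n⇒∃[o]m+o≡n m≤n
  ... | t , refl with count-+ m t
  ...   | e , eq , e≤t = ≤-trans (m≤m+n (close m) (t ∸ e)) (≤-reflexive (sym (close-+ {m} {t} eq e≤t)))

  close-suc-reject : ∀ n → ¬ P (suc n) → close (suc n) ≡ suc (close n)
  close-suc-reject n ¬Pn+1 rewrite count-suc-reject n ¬Pn+1 = +-∸-assoc 1 (count-≤ n)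

  close-reflects-≤ : ∀ n → ¬ P (suc n) → ∀ m → close (suc n) ≤ close m ⇔ suc n ≤ m
  close-reflects-≤ n ¬Pn+1 m = mk⇔ from close-monotone
    where
    from : close (suc n) ≤ close m → suc n ≤ m
    from le with suc n ≤? m
    ... | yes n<m = n<m
    ... | no  n≮m = contradiction le (<⇒≱ (begin-strict
      close m        ≤⟨ close-monotone (≤-pred (≰⇒> n≮m)) ⟩
      close n        <⟨ n<1+n (close n) ⟩
      suc (close n)  ≡⟨ close-suc-reject n ¬Pn+1 ⟨
      close (suc n)  ∎))
      where open ≤-Reasoning

module ColumnDeletion (ℓ : ℕ) (μ : List ℕ) where

  -- count is nDeletedUpTo ℓ μ, definitionally.
  open ClosingUp (deleted? ℓ μ) public

  part-Phi : Linked _≥_ μ → ∀ x → part (Phi ℓ μ) x ≡ close (part μ x)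
  part-Phi μ↘ x =
    trans (part-dropZeros (map⁺ (Linked.map close-monotone μ↘)) x) (part-map close refl μ x)

  conj-Phi : ∀ y → ¬ Deleted ℓ μ (suc y) → conj (Phi ℓ μ) (close (suc y)) ≡ conj μ (suc y)
  conj-Phi y ¬del = trans (conj-dropZeros (map close μ) (close (suc y)) 1≤close)
                          (conj-map close (close-reflects-≤ y ¬del) μ)
    where
    1≤close : 1 ≤ close (suc y)
    1≤close = subst (1 ≤_) (sym (close-suc-reject y ¬del)) (s≤s z≤n)

  hook-Phi : ∀ {x y} → Linked _≥_ μ → ¬ Deleted ℓ μ (suc y) →
             hook (Phi ℓ μ) x (close (suc y))
               ≡ (close (part μ x) ∸ close (suc y)) + (conj μ (suc y) ∸ x) + 1
  hook-Phi {x} {y} μ↘ ¬del rewrite part-Phi μ↘ x | conj-Phi y ¬del = refl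

  shift-reject : ∀ y → ¬ Deleted ℓ μ (suc y) → suc y ∸ shift ℓ μ (suc y) ≡ close (suc y)
  shift-reject y ¬del = cong (suc y ∸_) (sym (count-suc-reject y ¬del))

module BetaNumbers {lam : List ℕ} (isP : IsPartition lam) where

  k : ℕ
  k = length lam

  β : ℕ → ℕ
  β x = part lam x + (k ∸ x)

  γ : ℕ → ℕ
  γ y = (y ∸ 1) + (k ∸ conj lam y)

  lam↘ : Linked _≥_ lam
  lam↘ = proj₁ isP

  conj-1 : conj lam 1 ≡ k
  conj-1 = cong length (filter-all (1 ≤?_) (proj₂ isP))

  γ-1 : γ 1 ≡ 0
  γ-1 rewrite conj-1 = n∸n≡0 k

  box⇒≤conj : ∀ {x y} → InDiagram lam x y → x ≤ conj lam y
  box⇒≤conj {suc x} {y} (_ , 1≤y , y≤part) = ≤part⇒≤conj lam↘ x y 1≤y y≤part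

  hook+γ≡β : ∀ {x y} → InDiagram lam x y → hook lam x y + γ y ≡ β x
  hook+γ≡β {x} {suc y} b@(_ , _ , y<part) = begin
    (part lam x ∸ suc y) + (c ∸ x) + 1 + (y + (k ∸ c))
      ≡⟨ shuffle (part lam x ∸ suc y) (c ∸ x) y (k ∸ c) ⟩
    (part lam x ∸ suc y) + suc y + ((k ∸ c) + (c ∸ x))
      ≡⟨ cong₂ _+_ (m∸n+n≡m y<part) (sym (+-∸-assoc (k ∸ c) (box⇒≤conj b))) ⟩
    part lam x + ((k ∸ c) + c ∸ x)
      ≡⟨ cong (λ m → part lam x + (m ∸ x)) (m∸n+n≡m (conj-≤-length lam (suc y))) ⟩
    part lam x + (k ∸ x)
      ∎
    where
    open ≡-Reasoning
    c : ℕ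
    c = conj lam (suc y)
    shuffle : ∀ a b y d → a + b + 1 + (y + d) ≡ a + suc y + (d + b)
    shuffle = solve-∀

  box-first-column : ∀ {x} → 1 ≤ x → x ≤ k → InDiagram lam x 1
  box-first-column {suc x} 1≤x x≤k =
    1≤x , ≤-refl , ≤conj⇒≤part lam↘ x 1 (subst (suc x ≤_) (sym conj-1) x≤k)

  part-positive : ∀ {x} → 1 ≤ x → x ≤ k → 1 ≤ part lam x
  part-positive 1≤x x≤k = proj₂ (proj₂ (box-first-column 1≤x x≤k))

  row-end : ∀ {x} → 1 ≤ x → x ≤ k → InDiagram lam x (part lam x)
  row-end 1≤x x≤k = 1≤x , part-positive 1≤x x≤k , ≤-refl

  hook-first-column : ∀ {x} → 1 ≤ x → x ≤ k → hook lam x 1 ≡ β x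
  hook-first-column {x} 1≤x x≤k = begin
    hook lam x 1        ≡⟨ +-identityʳ (hook lam x 1) ⟨
    hook lam x 1 + 0    ≡⟨ cong (hook lam x 1 +_) γ-1 ⟨
    hook lam x 1 + γ 1  ≡⟨ hook+γ≡β (box-first-column 1≤x x≤k) ⟩
    β x                 ∎
    where open ≡-Reasoning

  γ<β : ∀ {x y} → InDiagram lam x y → γ y < β x
  γ<β {x} {y} b = subst (γ y <_) (hook+γ≡β b) (m<n+m (γ y) (0<hook lam x y))

  γ<γ-suc : ∀ {y} → 1 ≤ y → γ y < γ (suc y)
  γ<γ-suc {suc y} _ = s≤s (+-monoʳ-≤ y (∸-monoʳ-≤ k (conj-antitone lam (n≤1+n (suc y)))))

  γ-strictMono : ∀ {y z} → 1 ≤ y → y < z → γ y < γ z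
  γ-strictMono {y} 1≤y (s≤s y≤z′) with m≤n⇒m<n∨m≡n y≤z′
  ... | inj₂ refl = γ<γ-suc 1≤y
  ... | inj₁ y<z′ = <-trans (γ-strictMono 1≤y y<z′) (γ<γ-suc (≤-trans 1≤y (<⇒≤ y<z′)))

  γ-injective : ∀ {y z} → 1 ≤ y → 1 ≤ z → γ y ≡ γ z → y ≡ z
  γ-injective {y} {z} 1≤y 1≤z γy≡γz with <-cmp y z
  ... | tri< y<z _ _ = contradiction γy≡γz (<⇒≢ (γ-strictMono 1≤y y<z))
  ... | tri≈ _ y≡z _ = y≡z
  ... | tri> _ _ z<y = contradiction (sym γy≡γz) (<⇒≢ (γ-strictMono 1≤z z<y))

  β<γ : ∀ {x y} → 1 ≤ x → x ≤ k → part lam x < y → β x < γ y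
  β<γ {suc x} {y} _ x≤k part<y = begin-strict
    part lam (suc x) + (k ∸ suc x)  <⟨ +-monoʳ-< (part lam (suc x)) (∸-monoʳ-< conj<x x≤k) ⟩
    part lam (suc x) + (k ∸ c)      ≤⟨ +-monoˡ-≤ (k ∸ c) (≤-pred (≤-trans part<y (m≤n+m∸n y 1))) ⟩
    (y ∸ 1) + (k ∸ c)               ∎
    where
    open ≤-Reasoning
    c : ℕ
    c = conj lam y
    conj<x : c < suc x
    conj<x with suc x ≤? c
    ... | yes x≤c = contradiction (≤conj⇒≤part lam↘ x y x≤c) (<⇒≱ part<y)
    ... | no  x≰c = ≰⇒> x≰c

  γ-gap⇒β : ∀ {j n} → 1 ≤ j → γ j < n → n < γ (suc j) → ∃[ i ] (1 ≤ i × i ≤ k × β i ≡ n)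
  γ-gap⇒β {suc j} {n} _ lower upper with ∸-between (conj-≤-length lam (suc j)) lower upper
  ... | suc i , c₁<i , i≤c₀ , eq = suc i , s≤s z≤n , ≤-trans i≤c₀ (conj-≤-length lam (suc j)) ,
                                   trans (cong (_+ (k ∸ suc i)) part≡j) eq
    where
    part≡j : part lam (suc i) ≡ suc j
    part≡j with suc (suc j) ≤? part lam (suc i)
    ... | yes j<part = contradiction (≤part⇒≤conj lam↘ i (suc (suc j)) (s≤s z≤n) j<part) (<⇒≱ c₁<i)
    ... | no  j≮part = ≤-antisym (s≤s⁻¹ (≰⇒> j≮part)) (≤conj⇒≤part lam↘ i (suc j) i≤c₀)

  γ-onto-non-β : ∀ {x n} → 1 ≤ x → x ≤ k → n < β x →
                 (∀ {i} → 1 ≤ i → i ≤ k → β i ≢ n) →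
                 ∃[ y ] (InDiagram lam x y × γ y ≡ n)
  γ-onto-non-β {x} {n} 1≤x x≤k n<βx n∉β =
    search (part lam x) 1 (s≤s z≤n) (n≤1+n (part lam x)) (subst (_≤ n) (sym γ-1) z≤n)
    where
    search : ∀ fuel y → 1 ≤ y → part lam x ≤ y + fuel → γ y ≤ n →
             ∃[ y′ ] (InDiagram lam x y′ × γ y′ ≡ n)
    search fuel y 1≤y bound γy≤n with γ y ≟ n
    ... | yes γy≡n = y , (1≤x , 1≤y , y≤part) , γy≡n
      where
      y≤part : y ≤ part lam x
      y≤part with y ≤? part lam x
      ... | yes y≤p = y≤p
      ... | no  y≰p =
        contradiction (subst (_< β x) (sym γy≡n) n<βx) (<-asym (β<γ 1≤x x≤k (≰⇒> y≰p)))
    ... | no γy≢n with n <? γ (suc y)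
    ...   | yes n<γy′ with γ-gap⇒β 1≤y (≤∧≢⇒< γy≤n γy≢n) n<γy′
    ...     | i , 1≤i , i≤k , βi≡n = contradiction βi≡n (n∉β 1≤i i≤k)
    search zero y 1≤y bound γy≤n | no _ | no n≮γy′ =
      contradiction (≤-<-trans (≮⇒≥ n≮γy′) n<βx)
                    (<-asym (β<γ 1≤x x≤k (s≤s (subst (part lam x ≤_) (+-identityʳ y) bound))))
    search (suc fuel) y 1≤y bound γy≤n | no _ | no n≮γy′ =
      search fuel (suc y) (s≤s z≤n) (subst (part lam x ≤_) (+-suc y fuel) bound) (≮⇒≥ n≮γy′)

module CoreColumns {ℓ : ℕ} (ℓ≥2 : 2 ≤ ℓ) {lam : List ℕ} (isP : IsPartition lam)
                   (core : IsCore ℓ lam) (k≥1 : 1 ≤ length lam) where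

  open BetaNumbers isP
  open ColumnDeletion ℓ lam

  ℓ∤β : ∀ {x} → 1 ≤ x → x ≤ k → ¬ ℓ ∣ β x
  ℓ∤β {x} 1≤x x≤k ℓ∣βx =
    core x 1 (box-first-column 1≤x x≤k) (subst (ℓ ∣_) (sym (hook-first-column 1≤x x≤k)) ℓ∣βx)

  deleted⇔ℓ∣γ : ∀ {y} → 1 ≤ y → y ≤ part lam 1 → Deleted ℓ lam y ⇔ ℓ ∣ γ y
  deleted⇔ℓ∣γ {y} 1≤y y≤part₁ =
    mk⇔ (subst (ℓ ∣_) hook-difference) (subst (ℓ ∣_) (sym hook-difference))
    where
    h : ℕ
    h = hook lam 1 y
    hook-difference : ∣ h - hook lam 1 1 ∣ ≡ γ y
    hook-difference = begin
      ∣ h - hook lam 1 1 ∣  ≡⟨ cong (∣ h -_∣) (hook-first-column ≤-refl k≥1) ⟩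
      ∣ h - β 1 ∣           ≡⟨ cong (∣ h -_∣) (hook+γ≡β (≤-refl , 1≤y , y≤part₁)) ⟨
      ∣ h - h + γ y ∣       ≡⟨ ∣m-m+n∣≡n h (γ y) ⟩
      γ y                   ∎
      where open ≡-Reasoning

  ℓ∤γ-gap : ∀ {j m} → 1 ≤ j → γ j < m → m < γ (suc j) → ¬ ℓ ∣ m
  ℓ∤γ-gap 1≤j lower upper ℓ∣m with γ-gap⇒β 1≤j lower upper
  ... | i , 1≤i , i≤k , βi≡m = ℓ∤β 1≤i i≤k (subst (ℓ ∣_) (sym βi≡m) ℓ∣m)

  ≤-next-multiple : ∀ {j n} q → 1 ≤ j → γ j < suc q * ℓ → n ≤ γ (suc j) → n ≤ suc q * ℓ
  ≤-next-multiple {j} {n} q 1≤j γj<q′ℓ n≤γj′ with n ≤? suc q * ℓ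
  ... | yes n≤q′ℓ = n≤q′ℓ
  ... | no  n≰q′ℓ =
    contradiction (n∣m*n (suc q)) (ℓ∤γ-gap 1≤j γj<q′ℓ (<-≤-trans (≰⇒> n≰q′ℓ) n≤γj′))

  -- Deleted columns are those with ℓ ∣ γ y, and γ skips no multiple of ℓ: count j = ⌊γ j / ℓ⌋ + 1.
  count-γ : ∀ j → 1 ≤ j → j ≤ part lam 1 →
            ∃[ q ] (count j ≡ suc q × q * ℓ ≤ γ j × γ j < suc q * ℓ)
  count-γ (suc zero) _ 1≤part₁ = 0 , count-suc-accept 0 column-1-deleted , z≤n , γ1<ℓ
    where
    column-1-deleted : Deleted ℓ lam 1
    column-1-deleted =
      Equivalence.from (deleted⇔ℓ∣γ ≤-refl 1≤part₁) (subst (ℓ ∣_) (sym γ-1) (divides 0 refl))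
    γ1<ℓ : γ 1 < 1 * ℓ
    γ1<ℓ = subst₂ _<_ (sym γ-1) (sym (*-identityˡ ℓ)) (≤-trans (s≤s z≤n) ℓ≥2)
  count-γ (suc (suc j)) _ j′≤part₁
    with count-γ (suc j) (s≤s z≤n) (≤-trans (n≤1+n (suc j)) j′≤part₁)
  ... | q , count≡ , qℓ≤γ , γ<q′ℓ with deleted? ℓ lam (suc (suc j))
  ...   | yes del = suc q , trans (count-suc-accept (suc j) del) (cong suc count≡) ,
                    ≤-reflexive (sym γ≡q′ℓ) ,
                    subst (_< suc (suc q) * ℓ) (sym γ≡q′ℓ) (m<n+m (suc q * ℓ) ℓ>0)
    where
    ℓ>0 : 0 < ℓ
    ℓ>0 = ≤-trans (s≤s z≤n) ℓ≥2
    γ≡q′ℓ : γ (suc (suc j)) ≡ suc q * ℓ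
    γ≡q′ℓ = next-multiple q qℓ≤γ (γ<γ-suc (s≤s z≤n))
              (≤-next-multiple q (s≤s z≤n) γ<q′ℓ ≤-refl)
              (Equivalence.to (deleted⇔ℓ∣γ (s≤s z≤n) j′≤part₁) del)
  ...   | no ¬del = q , trans (count-suc-reject (suc j) ¬del) count≡ ,
                    ≤-trans qℓ≤γ (<⇒≤ (γ<γ-suc (s≤s z≤n))) ,
                    below-next-multiple q (≤-next-multiple q (s≤s z≤n) γ<q′ℓ ≤-refl)
                                        (¬del ∘ Equivalence.from (deleted⇔ℓ∣γ (s≤s z≤n) j′≤part₁))

  count-row-end : ∀ {x} → 1 ≤ x → x ≤ k →
                  ∃[ q ] (count (part lam x) ≡ suc q × q * ℓ < β x × β x < suc q * ℓ)
  count-row-end {x} 1≤x x≤k with count-γ (part lam x) (part-positive 1≤x x≤k) (part-≤-part₁ lam↘ x)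
  ... | q , count≡ , qℓ≤γ , γ<q′ℓ =
    q , count≡ , ≤-<-trans qℓ≤γ (γ<β (row-end 1≤x x≤k)) ,
    below-next-multiple q
      (≤-next-multiple q (part-positive 1≤x x≤k) γ<q′ℓ (<⇒≤ (β<γ 1≤x x≤k ≤-refl)))
      (ℓ∤β 1≤x x≤k)

  deleted⇔ℓ∣γ-box : ∀ {x y} → InDiagram lam x y → Deleted ℓ lam y ⇔ ℓ ∣ γ y
  deleted⇔ℓ∣γ-box {x} (_ , 1≤y , y≤part) =
    deleted⇔ℓ∣γ 1≤y (≤-trans y≤part (part-≤-part₁ lam↘ x))

  unique-small-deleted-box : ∀ x → 1 ≤ x → x ≤ k →
    ∃[ y ] ((InDiagram lam x y × Deleted ℓ lam y × hook lam x y < ℓ)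
      × (∀ y′ → InDiagram lam x y′ → Deleted ℓ lam y′ → hook lam x y′ < ℓ → y′ ≡ y))
  unique-small-deleted-box x 1≤x x≤k with count-row-end 1≤x x≤k
  ... | q , _ , qℓ<βx , βx<q′ℓ with γ-onto-non-β 1≤x x≤k qℓ<βx qℓ-not-β
    where
    qℓ-not-β : ∀ {i} → 1 ≤ i → i ≤ k → β i ≢ q * ℓ
    qℓ-not-β 1≤i i≤k βi≡qℓ = ℓ∤β 1≤i i≤k (divides q βi≡qℓ)
  ... | y , b , γy≡qℓ =
    y , (b , Equivalence.from (deleted⇔ℓ∣γ-box b) (divides q γy≡qℓ) , small) , unique
    where
    small : hook lam x y < ℓ
    small = +-cancelʳ-< (q * ℓ) (hook lam x y) ℓ
              (subst (_< suc q * ℓ) (trans (sym (hook+γ≡β b)) (cong (hook lam x y +_) γy≡qℓ)) βx<q′ℓ)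
    unique : ∀ y′ → InDiagram lam x y′ → Deleted ℓ lam y′ → hook lam x y′ < ℓ → y′ ≡ y
    unique y′ b′ del′ small′ with Equivalence.to (deleted⇔ℓ∣γ-box b′) del′
    ... | divides t γy′≡tℓ = γ-injective (proj₁ (proj₂ b′)) (proj₁ (proj₂ b))
                                         (trans γy′≡tℓ (trans (cong (_* ℓ) (sym q≡t)) (sym γy≡qℓ)))
      where
      q≡t : q ≡ t
      q≡t = quotient-unique (<⇒≤ qℓ<βx) βx<q′ℓ (subst (_≤ β x) γy′≡tℓ (<⇒≤ (γ<β b′)))
              (subst (_< suc t * ℓ) (trans (cong (hook lam x y′ +_) (sym γy′≡tℓ)) (hook+γ≡β b′))
                     (+-monoˡ-< (t * ℓ) small′))

  kept-box-hooks : ∀ {x y} → InDiagram lam x (suc y) → ¬ Deleted ℓ lam (suc y) →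
    ∃[ e ] (hook (Phi ℓ lam) x (suc y ∸ shift ℓ lam (suc y)) + e ≡ hook lam x (suc y)
            × count (part lam x) ≡ count (suc y) + e)
  kept-box-hooks {x} {y} (_ , _ , y<part) ¬del with count-+ (suc y) (part lam x ∸ suc y)
  ... | e , count≡ , e≤t = e , hooks , trans (cong count (sym row)) count≡
    where
    open ≡-Reasoning
    t L : ℕ
    t = part lam x ∸ suc y
    L = conj lam (suc y) ∸ x
    row : suc y + t ≡ part lam x
    row = m+[n∸m]≡n y<part
    close-gap : close (part lam x) ∸ close (suc y) ≡ t ∸ e
    close-gap = begin
      close (part lam x) ∸ close (suc y)       ≡⟨ cong (λ p → close p ∸ close (suc y)) row ⟨
      close (suc y + t) ∸ close (suc y)        ≡⟨ cong (_∸ close (suc y)) (close-+ {suc y} {t} count≡ e≤t) ⟩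
      close (suc y) + (t ∸ e) ∸ close (suc y)  ≡⟨ m+n∸m≡n (close (suc y)) (t ∸ e) ⟩
      t ∸ e                                    ∎
    hooks : hook (Phi ℓ lam) x (suc y ∸ shift ℓ lam (suc y)) + e ≡ t + L + 1
    hooks = begin
      hook (Phi ℓ lam) x (suc y ∸ shift ℓ lam (suc y)) + e ≡⟨ cong (λ z → hook (Phi ℓ lam) x z + e)
                                                                (shift-reject y ¬del) ⟩
      hook (Phi ℓ lam) x (close (suc y)) + e             ≡⟨ cong (_+ e) (hook-Phi lam↘ ¬del) ⟩
      (close (part lam x) ∸ close (suc y)) + L + 1 + e   ≡⟨ cong (λ d → d + L + 1 + e) close-gap ⟩
      (t ∸ e) + L + 1 + e                                ≡⟨ shuffle (t ∸ e) L e ⟩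
      (t ∸ e) + e + L + 1                                ≡⟨ cong (λ d → d + L + 1) (m∸n+n≡m e≤t) ⟩
      t + L + 1                                          ∎
      where
      shuffle : ∀ d L e → d + L + 1 + e ≡ d + e + L + 1
      shuffle = solve-∀

  kept-box-small⇔ : ∀ x y → InDiagram lam x y → ¬ Deleted ℓ lam y →
    (hook lam x y < ℓ ⇔ hook (Phi ℓ lam) x (y ∸ shift ℓ lam y) < ℓ ∸ 1)
  kept-box-small⇔ x (suc y) b@(1≤x , 1≤y , y≤part) ¬del
    with kept-box-hooks b ¬del
       | count-γ (suc y) 1≤y (≤-trans y≤part (part-≤-part₁ lam↘ x))
       | count-row-end 1≤x (≤-trans (box⇒≤conj b) (conj-≤-length lam (suc y)))
  ... | e , hooks , count≡ | qy , county≡ , qyℓ≤γ , γ<qy′ℓ | qx , countx≡ , qxℓ<β , β<qx′ℓ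
    with difference-window {B = qy} {e = e} qyℓ<γ γ<qy′ℓ (subst (λ q → q * ℓ < β x) qx≡qy+e qxℓ<β)
                                     (subst (λ q → β x < suc q * ℓ) qx≡qy+e β<qx′ℓ) (hook+γ≡β b)
    where
    qyℓ<γ : qy * ℓ < γ (suc y)
    qyℓ<γ = ≤∧≢⇒< qyℓ≤γ (¬del ∘ Equivalence.from (deleted⇔ℓ∣γ-box b) ∘ divides qy ∘ sym)
    qx≡qy+e : qx ≡ qy + e
    qx≡qy+e = suc-injective (trans (sym countx≡) (trans count≡ (cong (_+ e) county≡)))
  ... | upper , lower = window-drop-<-iff ℓ≥2 upper lower hooks

lemma5p2 : (ℓ k : ℕ) → 2 ≤ ℓ → 1 ≤ k → (lam : List ℕ) → IsPartition lam → IsCore ℓ lam → length lam ≡ k →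
    ((x : ℕ) → 1 ≤ x → x ≤ k →
      ∃[ y ] ((InDiagram lam x y × Deleted ℓ lam y × hook lam x y < ℓ)
        × ((y′ : ℕ) → InDiagram lam x y′ → Deleted ℓ lam y′ → hook lam x y′ < ℓ → y′ ≡ y)))
    × ((x y : ℕ) → InDiagram lam x y → ¬ Deleted ℓ lam y →
      (hook lam x y < ℓ ⇔ hook (Phi ℓ lam) x (y ∸ shift ℓ lam y) < ℓ ∸ 1))
lemma5p2 ℓ .(length lam) ℓ≥2 k≥1 lam isP core refl = unique-small-deleted-box , kept-box-small⇔
  where open CoreColumns ℓ≥2 isP core k≥1
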